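{- Let $G=(X,Y,E)$, $\mathcal{P}_X$, $\mathcal{P}_Y$ be an instance of MIN-REP and let $G'$ be the graph constructed from it as described in the context. Let $X_i$ and $Y_j$ form a super edge and let $D\subseteq V(G')$. Then $D$ covers both target couples $[px^1_i,py^1_j]$ and $[px^2_i,py^2_j]$ if and only if at least one of the following holds: (1) there exist $x\in X$ and $y\in Y$ such that $(px^1_i,x,y,py^1_j)$ and $(px^2_i,x,y,py^2_j)$ are paths in $G'$ and $\{x,y\}\subseteq D$; (2) $\{r^1_{i,j},r^2_{i,j}\}\subseteq D$.
   Context: MIN-REP instance: a bipartite graph $G=(X,Y,E)$, a partition $\mathcal{P}_X=\{X_1,\dots,X_{k_X}\}$ of $X$ into sets of size $|X|/k_X$, and a partition $\mathcal{P}_Y=\{Y_1,\dots,Y_{k_Y}\}$ of $Y$ into sets of size $|Y|/k_Y$. $X_i$ and $Y_j$ form a super edge if some vertex of $X_i$ is adjacent in $G$ to some vertex of $Y_j$. Construction of $G'$: start with $G$. For each $X_i$ add two vertices $px^1_i,px^2_i$ and edges $(x,px^1_i),(x,px^2_i)$ for every $x\in X_i$; for each $Y_j$ add two vertices $py^1_j,py^2_j$ and edges $(y,py^1_j),(y,py^2_j)$ for every $y\in Y_j$. For each super edge $(X_i,Y_j)$ add two vertices (relays) $r^1_{i,j},r^2_{i,j}$ and edges $(px^1_i,r^1_{i,j}),(r^1_{i,j},py^1_j),(px^2_i,r^2_{i,j}),(r^2_{i,j},py^2_j)$. Let $PX$ be the set of all $px^I_i$, $PY$ the set of all $py^I_j$,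 $R$ the set of relays. Add four hubs $h_{X,R},h_{Y,R},h_{PX},h_{PY}$: $h_{X,R}$ is adjacent to every vertex of $X\cup R$, $h_{Y,R}$ to every vertex of $Y\cup R$, $h_{PX}$ to every vertex of $PX$, $h_{PY}$ to every vertex of $PY$, and the hubs form the 4-cycle $(h_{PX},h_{Y,R},h_{PY},h_{X,R},h_{PX})$. Finally, for each hub $h$ add two new vertices (dummy nodes) $d_1,d_2$ and edges $(h,d_1),(h,d_2)$. Covering: for vertices $u,v$ of $G'$, $m_{G'}(u,v)$ is the number of internal vertices on a shortest $u$–$v$ path ($\infty$ if none); for $D\subseteq V(G')$, $m^D(u,v)=m_{G'[D\cup\{u,v\}]}(u,v)$. Vertices $u,v$ form a target couple $[u,v]$ if $m_{G'}(u,v)=1$. $D$ covers $[u,v]$ if $m^D(u,v)\le 2$. -}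

module Defs where

open import Data.Nat using (ℕ; _≤_)
open import Data.Fin using (Fin; zero; suc)
open import Data.Bool using (Bool; T)
open import Data.Product using (_×_; _,_; Σ; ∃-syntax)
open import Data.Sum using (_⊎_)
open import Data.List using (List; []; _∷_; _++_; length; allFin)
open import Data.Bool.ListAction using (any)
open import Data.List.Relation.Unary.All using (All)
open import Data.List.Relation.Unary.Linked using (Linked)
open import Data.List.Relation.Unary.Unique.Propositional using (Unique)
open import Relation.Binary.PropositionalEquality using (_≡_)

-- X is partitioned into kX blocks X_1..X_kX, each of
-- size sX (= |X|/kX); a vertex of X is encoded as (block index, position in
-- block).  Likewise for Y.
record MinRep : Set where
  field
    kX sX kY sY : ℕ
    E : Fin kX × Fin sX → Fin kY × Fin sY → Bool

module Construction (M : MinRep) where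
  open MinRep M

  XV : Set
  XV = Fin kX × Fin sX

  YV : Set
  YV = Fin kY × Fin sY

  blkX : XV → Fin kX
  blkX (i , _) = i

  blkY : YV → Fin kY
  blkY (j , _) = j

  superEdge : Fin kX → Fin kY → Bool
  superEdge i j = any (λ a → any (λ b → E (i , a) (j , b)) (allFin sY)) (allFin sX)

  SuperEdge : Fin kX → Fin kY → Set
  SuperEdge i j = T (superEdge i j)

  data Hub : Set where
    hXR hYR hPX hPY : Hub

  -- vertices of G'.  The superscript I ∈ {1,2} is encoded by Fin 2
  -- (zero ↦ 1, suc zero ↦ 2).  Relays exist only for super edges.
  data V : Set where
    xv    : XV → V
    yv    : YV → V
    px    : Fin 2 → Fin kX → V
    py    : Fin 2 → Fin kY → V
    rl    : Fin 2 → (i : Fin kX) → (j : Fin kY) → SuperEdge i j → V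
    hub   : Hub → V
    dummy : Hub → Fin 2 → V

  -- one orientation of each edge of G'
  data Arc : V → V → Set where
    g-edge  : ∀ x y → T (E x y) → Arc (xv x) (yv y)
    x-px    : ∀ I x → Arc (xv x) (px I (blkX x))
    y-py    : ∀ I y → Arc (yv y) (py I (blkY y))
    px-r    : ∀ I i j s → Arc (px I i) (rl I i j s)
    r-py    : ∀ I i j s → Arc (rl I i j s) (py I j)
    hXR-x   : ∀ x → Arc (hub hXR) (xv x)
    hXR-r   : ∀ I i j s → Arc (hub hXR) (rl I i j s)
    hYR-y   : ∀ y → Arc (hub hYR) (yv y)
    hYR-r   : ∀ I i j s → Arc (hub hYR) (rl I i j s)
    hPX-px  : ∀ I i → Arc (hub hPX) (px I i)
    hPY-py  : ∀ I j → Arc (hub hPY) (py I j)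
    c1      : Arc (hub hPX) (hub hYR)
    c2      : Arc (hub hYR) (hub hPY)
    c3      : Arc (hub hPY) (hub hXR)
    c4      : Arc (hub hXR) (hub hPX)
    h-dummy : ∀ h k → Arc (hub h) (dummy h k)

  Adj : V → V → Set
  Adj u v = Arc u v ⊎ Arc v u

  IsPath : List V → Set
  IsPath p = Unique p × Linked Adj p

  -- a path from u to v with internal vertices ws, lying in the induced
  -- subgraph G'[D ∪ {u,v}]  (D given as a predicate on V)
  InducedPath : (V → Set) → V → V → List V → Set
  InducedPath D u v ws =
    IsPath (u ∷ ws ++ v ∷ []) × All (λ w → D w ⊎ (w ≡ u ⊎ w ≡ v)) ws

  -- D covers [u,v]  :⇔  m^D(u,v) ≤ 2, i.e. some u–v path in
  -- G'[D ∪ {u,v}] has at most 2 internal vertices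
  Covers : (V → Set) → V → V → Set
  Covers D u v = ∃[ ws ] (length ws ≤ 2 × InducedPath D u v ws)

module Submission where

-- A target couple [px^I_i, py^I_j] is covered by D iff some px^I_i–py^I_j path
-- with at most two internal vertices runs through D.  The proof classifies all
-- such short paths in G':
--   * px^I_i and py^I_j are not adjacent, so there is at least one internal vertex;
--   * their only common neighbours are the relays r^I_{i,j};
--   * the only edges from a neighbour of px^I_i to a neighbour of py^I_j are the
--     edges of G between X_i and Y_j.
-- Since the vertices of a path are distinct, the internal vertices of an induced
-- path lie in D itself.  Hence D covers [px^I_i, py^I_j] iff D contains the relay
-- r^I_{i,j} or a "bridge": an edge x–y of G with x ∈ X_i, y ∈ Y_j, {x,y} ⊆ D
-- (lemma coversCouple).  A bridge serves both superscripts I = 1, 2 at once, which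
-- gives the two alternatives of lemma7.

open import Defs
open import Data.Bool using (T)
open import Data.Bool.Properties using (T-irrelevant)
open import Data.Empty using (⊥-elim)
open import Data.Fin using (Fin; zero; suc)
open import Data.Nat using (_≤_; s≤s; z≤n)
open import Data.Product using (_×_; ∃-syntax; Σ; _,_)
open import Data.Sum using (_⊎_; inj₁; inj₂)
open import Data.List using (List; []; _∷_; _++_; length)
open import Data.List.Relation.Unary.All as All using (All; []; _∷_)
open import Data.List.Relation.Unary.All.Properties using (++⁻ʳ)
open import Data.List.Relation.Unary.AllPairs using ([]; _∷_)
open import Data.List.Relation.Unary.Linked using (Linked; [-]; _∷_)
open import Data.List.Relation.Unary.Unique.Propositional using (Unique)
open import Function.Bundles using (_⇔_; mk⇔; Equivalence)
open import Relation.Nullary using (¬_)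
open import Relation.Binary.PropositionalEquality using (_≡_; _≢_; refl; sym; cong; subst)

awayFromEndpoints : ∀ {A : Set} {D : A → Set} {u v w : A} →
  u ≢ w → w ≢ v → D w ⊎ (w ≡ u ⊎ w ≡ v) → D w
awayFromEndpoints _   _   (inj₁ d)         = d
awayFromEndpoints u≢w _   (inj₂ (inj₁ eq)) = ⊥-elim (u≢w (sym eq))
awayFromEndpoints _   w≢v (inj₂ (inj₂ eq)) = ⊥-elim (w≢v eq)

-- The internal vertices ws of a repetition-free sequence u, ws, v differ from
-- both endpoints; so if each of them lies in D ∪ {u,v}, each lies in D.
internalVerticesInside : ∀ {A : Set} {D : A → Set} {u v : A} (ws : List A) →
  Unique (u ∷ ws ++ v ∷ []) → All (λ w → D w ⊎ (w ≡ u ⊎ w ≡ v)) ws → All D ws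
internalVerticesInside [] _ [] = []
internalVerticesInside {D = D} (w ∷ ws) ((u≢w ∷ u≢rest) ∷ w≢rest ∷ restUnique) (dw ∷ dws)
  with ++⁻ʳ ws w≢rest
... | w≢v ∷ [] =
  awayFromEndpoints {D = D} u≢w w≢v dw ∷ internalVerticesInside ws (u≢rest ∷ restUnique) dws

module ShortPaths (M : MinRep) where
  open MinRep M
  open Construction M

  data PxNeighbour (I : Fin 2) (i : Fin kX) : V → Set where
    x-nb   : ∀ a → PxNeighbour I i (xv (i , a))
    r-nb   : ∀ j s → PxNeighbour I i (rl I i j s)
    hub-nb : PxNeighbour I i (hub hPX)

  pxNeighbour : ∀ {I i w} → Adj (px I i) w → PxNeighbour I i w
  pxNeighbour (inj₁ (px-r _ _ j s))    = r-nb j s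
  pxNeighbour (inj₂ (x-px _ (_ , a)))  = x-nb a
  pxNeighbour (inj₂ (hPX-px _ _))      = hub-nb

  data PyNeighbour (I : Fin 2) (j : Fin kY) : V → Set where
    y-nb   : ∀ b → PyNeighbour I j (yv (j , b))
    r-nb   : ∀ i s → PyNeighbour I j (rl I i j s)
    hub-nb : PyNeighbour I j (hub hPY)

  pyNeighbour : ∀ {I j w} → Adj w (py I j) → PyNeighbour I j w
  pyNeighbour (inj₁ (y-py _ (_ , b)))  = y-nb b
  pyNeighbour (inj₁ (r-py _ i _ s))    = r-nb i s
  pyNeighbour (inj₁ (hPY-py _ _))      = hub-nb

  px≁py : ∀ {I J i j} → ¬ Adj (px I i) (py J j)
  px≁py (inj₁ ())
  px≁py (inj₂ ())

  commonNeighbour : ∀ {I i j w} → PxNeighbour I i w → PyNeighbour I j w →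
    Σ (SuperEdge i j) λ s → w ≡ rl I i j s
  commonNeighbour (x-nb _)   ()
  commonNeighbour (r-nb _ s) (r-nb _ _) = s , refl
  commonNeighbour hub-nb     ()

  bridgeEdge : ∀ {I i j w w'} → PxNeighbour I i w → PyNeighbour I j w' → Adj w w' →
    ∃[ a ] ∃[ b ] T (E (i , a) (j , b)) × w ≡ xv (i , a) × w' ≡ yv (j , b)
  bridgeEdge (x-nb a) (y-nb b) (inj₁ (g-edge _ _ e)) = a , b , e , refl , refl
  bridgeEdge (x-nb _) (y-nb _)   (inj₂ ())
  bridgeEdge (x-nb _) (r-nb _ _) (inj₁ ())
  bridgeEdge (x-nb _) (r-nb _ _) (inj₂ ())
  bridgeEdge (x-nb _) hub-nb     (inj₁ ())
  bridgeEdge (x-nb _) hub-nb     (inj₂ ())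
  bridgeEdge (r-nb _ _) (y-nb _)   (inj₁ ())
  bridgeEdge (r-nb _ _) (y-nb _)   (inj₂ ())
  bridgeEdge (r-nb _ _) (r-nb _ _) (inj₁ ())
  bridgeEdge (r-nb _ _) (r-nb _ _) (inj₂ ())
  bridgeEdge (r-nb _ _) hub-nb     (inj₁ ())
  bridgeEdge (r-nb _ _) hub-nb     (inj₂ ())
  bridgeEdge hub-nb (y-nb _)   (inj₁ ())
  bridgeEdge hub-nb (y-nb _)   (inj₂ ())
  bridgeEdge hub-nb (r-nb _ _) (inj₁ ())
  bridgeEdge hub-nb (r-nb _ _) (inj₂ ())
  bridgeEdge hub-nb hub-nb     (inj₁ ())
  bridgeEdge hub-nb hub-nb     (inj₂ ())

  Bridge : (V → Set) → Fin kX → Fin kY → Set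
  Bridge D i j = ∃[ a ] ∃[ b ] T (E (i , a) (j , b)) × D (xv (i , a)) × D (yv (j , b))

  relayWitnessIrrelevant : ∀ {I i j} (s s' : SuperEdge i j) → rl I i j s ≡ rl I i j s'
  relayWitnessIrrelevant s s' = cong (rl _ _ _) (T-irrelevant s s')

  relayPath : ∀ I i j (s : SuperEdge i j) → IsPath (px I i ∷ rl I i j s ∷ py I j ∷ [])
  relayPath I i j s =
    ((λ ()) ∷ (λ ()) ∷ []) ∷ ((λ ()) ∷ []) ∷ [] ∷ []
    , inj₁ (px-r I i j s) ∷ inj₁ (r-py I i j s) ∷ [-]

  bridgePath : ∀ I {i j a b} → T (E (i , a) (j , b)) →
    IsPath (px I i ∷ xv (i , a) ∷ yv (j , b) ∷ py I j ∷ [])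
  bridgePath I {i} {j} {a} {b} e =
    ((λ ()) ∷ (λ ()) ∷ (λ ()) ∷ []) ∷ ((λ ()) ∷ (λ ()) ∷ []) ∷ ((λ ()) ∷ []) ∷ [] ∷ []
    , inj₂ (x-px I (i , a)) ∷ inj₁ (g-edge (i , a) (j , b) e) ∷ inj₁ (y-py I (j , b)) ∷ [-]

  coversAlong : ∀ {D u v} ws → length ws ≤ 2 →
    IsPath (u ∷ ws ++ v ∷ []) → All D ws → Covers D u v
  coversAlong ws short path inD = ws , short , path , All.map inj₁ inD

  shortRoute : ∀ {D I i j} (s : SuperEdge i j) ws → length ws ≤ 2 →
    Linked Adj (px I i ∷ ws ++ py I j ∷ []) → All D ws → D (rl I i j s) ⊎ Bridge D i j
  shortRoute s [] _ (adjacent ∷ _) _ = ⊥-elim (px≁py adjacent)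
  shortRoute {D} s (_ ∷ []) _ (toW ∷ fromW ∷ [-]) (dw ∷ [])
    with commonNeighbour (pxNeighbour toW) (pyNeighbour fromW)
  ... | s' , refl = inj₁ (subst D (relayWitnessIrrelevant s' s) dw)
  shortRoute s (_ ∷ _ ∷ []) _ (toW ∷ edge ∷ fromW' ∷ [-]) (dw ∷ dw' ∷ [])
    with bridgeEdge (pxNeighbour toW) (pyNeighbour fromW') edge
  ... | a , b , e , refl , refl = inj₂ (a , b , e , dw , dw')
  shortRoute s (_ ∷ _ ∷ _ ∷ _) (s≤s (s≤s ())) _ _

  coversCouple : ∀ {D I i j} (s : SuperEdge i j) →
    Covers D (px I i) (py I j) ⇔ (D (rl I i j s) ⊎ Bridge D i j)
  coversCouple {D} {I} {i} {j} s = mk⇔ classify realise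
    where
    classify : Covers D (px I i) (py I j) → D (rl I i j s) ⊎ Bridge D i j
    classify (ws , short , (distinct , linked) , inDuv) =
      shortRoute s ws short linked (internalVerticesInside ws distinct inDuv)

    realise : D (rl I i j s) ⊎ Bridge D i j → Covers D (px I i) (py I j)
    realise (inj₁ dr) = coversAlong (_ ∷ []) (s≤s z≤n) (relayPath I i j s) (dr ∷ [])
    realise (inj₂ (_ , _ , e , dx , dy)) =
      coversAlong (_ ∷ _ ∷ []) (s≤s (s≤s z≤n)) (bridgePath I e) (dx ∷ dy ∷ [])

  BothCouplesCovered : (V → Set) → Fin kX → Fin kY → Set
  BothCouplesCovered D i j =
    Covers D (px zero i) (py zero j) × Covers D (px (suc zero) i) (py (suc zero) j)

  SharedEdge : (V → Set) → Fin kX → Fin kY → Set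
  SharedEdge D i j = ∃[ x ] ∃[ y ]
    (IsPath (px zero i ∷ xv x ∷ yv y ∷ py zero j ∷ [])
     × IsPath (px (suc zero) i ∷ xv x ∷ yv y ∷ py (suc zero) j ∷ [])
     × D (xv x) × D (yv y))

  BothRelays : (V → Set) → (i : Fin kX) → (j : Fin kY) → SuperEdge i j → Set
  BothRelays D i j s = D (rl zero i j s) × D (rl (suc zero) i j s)

  bridgeShared : ∀ {D i j} → Bridge D i j → SharedEdge D i j
  bridgeShared (_ , _ , e , dx , dy) =
    _ , _ , bridgePath zero e , bridgePath (suc zero) e , dx , dy

lemma7 : (M : MinRep) → let open MinRep M in let open Construction M in
    (i : Fin kX) → (j : Fin kY) → (s : SuperEdge i j) → (D : V → Set) →
      (Covers D (px zero i) (py zero j) × Covers D (px (suc zero) i) (py (suc zero) j))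
      ⇔
      ((∃[ x ] ∃[ y ]
          (IsPath (px zero i ∷ xv x ∷ yv y ∷ py zero j ∷ [])
           × IsPath (px (suc zero) i ∷ xv x ∷ yv y ∷ py (suc zero) j ∷ [])
           × D (xv x) × D (yv y)))
       ⊎ (D (rl zero i j s) × D (rl (suc zero) i j s)))
lemma7 M i j s D = mk⇔ fromCovers toCovers
  where
  open ShortPaths M
  open Equivalence

  fromCovers : BothCouplesCovered D i j → SharedEdge D i j ⊎ BothRelays D i j s
  fromCovers (covers₁ , covers₂)
    with to (coversCouple s) covers₁ | to (coversCouple s) covers₂
  ... | inj₂ bridge | _           = inj₁ (bridgeShared {D} bridge)
  ... | inj₁ _      | inj₂ bridge = inj₁ (bridgeShared {D} bridge)
  ... | inj₁ relay₁ | inj₁ relay₂ = inj₂ (relay₁ , relay₂)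

  toCovers : SharedEdge D i j ⊎ BothRelays D i j s → BothCouplesCovered D i j
  toCovers (inj₁ (_ , _ , path₁ , path₂ , dx , dy)) =
    coversAlong {D} (_ ∷ _ ∷ []) (s≤s (s≤s z≤n)) path₁ (dx ∷ dy ∷ [])
    , coversAlong {D} (_ ∷ _ ∷ []) (s≤s (s≤s z≤n)) path₂ (dx ∷ dy ∷ [])
  toCovers (inj₂ (relay₁ , relay₂)) =
    from (coversCouple s) (inj₁ relay₁) , from (coversCouple s) (inj₁ relay₂)
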